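{- Let $R$ be a relation on $\{0,1\}$ that is not affine and let $a\in\{0,1\}$. Then $\langle\{R,\mathrm{NEQ},\delta_a\}\rangle_{\max}$ is the set of all relations on $\{0,1\}$.
   Context: A relation is affine if it is the solution set of a system of linear equations over $\mathrm{GF}(2)$. Max-implementation: for an $(n+m)$-ary $R$, $\exists_{\max}(y_1,\dots,y_m)R$ consists of those $\mathbf a\in\{0,1\}^n$ whose number of extensions $\mathbf b\in\{0,1\}^m$ with $(\mathbf a,\mathbf b)\in R$ is maximal over all of $\{0,1\}^n$. $\langle\Gamma\rangle_{\max}$ is the smallest set of relations containing $\Gamma$ and $\mathrm{EQ}=\{(0,0),(1,1)\}$, closed under manipulations with variables (renaming, permuting, identifying variables), conjunction and max-implementation. $\mathrm{NEQ}=\{(0,1),(1,0)\}$, $\delta_0=\{(0)\}$, $\delta_1=\{(1)\}$. -}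

module Defs where

open import Data.Bool using (Bool; true; false; _∧_; _xor_; not; if_then_else_)
open import Data.Nat using (ℕ; zero; suc; _+_; _⊔_; _≡ᵇ_)
open import Data.Fin using (Fin)
open import Data.Vec using (Vec; []; _∷_; _++_; take; drop; lookup; tabulate)
open import Data.List as L using (List)
open import Data.Product using (Σ; _×_)
open import Relation.Binary.PropositionalEquality using (_≡_)

-- An n-ary relation on {0,1} (0 = false, 1 = true), given by its
-- characteristic function on n-tuples.
Rel₂ : ℕ → Set
Rel₂ n = Vec Bool n → Bool

dot : ∀ {n} → Vec Bool n → Vec Bool n → Bool
dot [] [] = false
dot (a ∷ as) (x ∷ xs) = (a ∧ x) xor dot as xs

Affine : ∀ {n} → Rel₂ n → Set
Affine {n} R =
  Σ ℕ λ m → Σ (Vec (Vec Bool n) m) λ A → Σ (Vec Bool m) λ b →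
    ∀ (x : Vec Bool n) →
      (R x ≡ true → ∀ (i : Fin m) → dot (lookup A i) x ≡ lookup b i)
      × ((∀ (i : Fin m) → dot (lookup A i) x ≡ lookup b i) → R x ≡ true)

EQ NEQ : Rel₂ 2
EQ (x ∷ y ∷ []) = not (x xor y)
NEQ (x ∷ y ∷ []) = x xor y

δ : Bool → Rel₂ 1
δ a (x ∷ []) = not (a xor x)

allVecs : ∀ n → List (Vec Bool n)
allVecs zero = [] L.∷ L.[]
allVecs (suc n) = L.map (false ∷_) (allVecs n) L.++ L.map (true ∷_) (allVecs n)

-- Manipulation with variables: T(y₁..y_m) = S(y_σ(1),...,y_σ(n))
-- (covers renaming, permuting, identifying variables).
manip : ∀ {n m} → (Fin n → Fin m) → Rel₂ n → Rel₂ m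
manip σ S y = S (tabulate (λ i → lookup y (σ i)))

-- Conjunction on disjoint variable sets (shared variables via manip).
conj : ∀ {n m} → Rel₂ n → Rel₂ m → Rel₂ (n + m)
conj {n} S T v = S (take n v) ∧ T (drop n v)

extCount : ∀ {n} m → Rel₂ (n + m) → Vec Bool n → ℕ
extCount m S a = L.length (L.filterᵇ (λ b → S (a ++ b)) (allVecs m))

maxImpl : ∀ {n} m → Rel₂ (n + m) → Rel₂ n
maxImpl {n} m S a =
  extCount m S a ≡ᵇ L.foldr _⊔_ 0 (L.map (extCount m S) (allVecs n))

data ⟨_,NEQ,δ_⟩max {k : ℕ} (R : Rel₂ k) (a : Bool) : ∀ {n} → Rel₂ n → Set where
  gen-R   : ⟨ R ,NEQ,δ a ⟩max R
  gen-NEQ : ⟨ R ,NEQ,δ a ⟩max NEQ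
  gen-δ   : ⟨ R ,NEQ,δ a ⟩max (δ a)
  gen-EQ  : ⟨ R ,NEQ,δ a ⟩max EQ
  cl-manip : ∀ {n m} {S : Rel₂ n} (σ : Fin n → Fin m) →
    ⟨ R ,NEQ,δ a ⟩max S → ⟨ R ,NEQ,δ a ⟩max (manip σ S)
  cl-conj : ∀ {n m} {S : Rel₂ n} {T : Rel₂ m} →
    ⟨ R ,NEQ,δ a ⟩max S → ⟨ R ,NEQ,δ a ⟩max T → ⟨ R ,NEQ,δ a ⟩max (conj S T)
  cl-max : ∀ {n} m {S : Rel₂ (n + m)} →
    ⟨ R ,NEQ,δ a ⟩max S → ⟨ R ,NEQ,δ a ⟩max (maxImpl {n} m S)
  -- relations are sets: membership is invariant under extensional equality
  cl-ext : ∀ {n} {S T : Rel₂ n} →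
    ⟨ R ,NEQ,δ a ⟩max S → (∀ x → S x ≡ T x) → ⟨ R ,NEQ,δ a ⟩max T

-- Strategy.  ∃max is mostly used as an ordinary projection: when every tuple
-- has at most one witness, and some tuple has one, ∃max projects exactly
-- (`unique-projection`); this rests on a small counting layer over {0,1}^m.
-- Relations between concrete small relations are checked by evaluation.
--   1. From δ_a and NEQ we obtain both constants δ_0, δ_1.
--   2. A relation closed under x ⊕ y ⊕ z is affine (by induction on the
--      arity, fibre by fibre); hence R has x, y, z ∈ R with x ⊕ y ⊕ z ∉ R.
--   3. Substituting the eight literals u₁,u₂,u₃,¬u₁,¬u₂,¬u₃,0,1 into R
--      according to the columns of (x,y,z) yields a ternary relation that
--      contains 100, 010, 001 but not 111 (`NonAff3`).
--   4. Pinning or projecting one coordinate of it gives NAND or OR, and with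
--      NEQ both.  From these, a counting gadget (the genuine use of ∃max)
--      gives NAE₃, then the graph of NAND, then the multiplexer MUX.
--   5. By Shannon expansion the graph of every Boolean function is in the
--      closure; every nonempty S is the projection of Graph S ∧ δ_1, and the
--      empty relation is δ_0 ∧ δ_1 on one variable.
module Submission where

open import Defs
open import Algebra using (CommutativeRing)
open import Data.Bool using (Bool; true; false; _∧_; _∨_; _xor_; not; if_then_else_)
open import Data.Bool.Properties
  using (_≟_; ¬-not; T-≡; ∧-conicalˡ; ∧-conicalʳ; ∧-identityʳ; ∧-zeroʳ; xor-assoc; xor-comm; xor-same;
         xor-identityʳ; ∧-distribˡ-xor; xor-∧-commutativeRing)
open import Data.Bool.ListAction using (any)
open import Data.Empty using (⊥-elim)
open import Data.Fin using (Fin; zero; suc; _↑ˡ_; _↑ʳ_; #_)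
open import Data.List as L using (List)
open import Data.List.Membership.Propositional using (_∈_; lose)
open import Data.List.Membership.Propositional.Properties using (∈-map⁺; ∈-++⁺ˡ; ∈-++⁺ʳ)
open import Data.List.Properties using (filter-++; length-++; map-cong)
open import Data.List.Relation.Unary.Any using (here)
open import Data.List.Relation.Unary.Any.Properties using (any⁺)
open import Data.Nat using (ℕ; zero; suc; _+_; _⊔_; _≡ᵇ_)
open import Data.Product using (∃; _×_; _,_; proj₁; proj₂)
open import Data.Sum using (_⊎_; inj₁; inj₂)
open import Data.Vec using (Vec; []; _∷_; _++_; take; drop; lookup; tabulate; replicate; map; zipWith)
open import Data.Vec.Properties
  using (lookup-++ˡ; lookup-++ʳ; tabulate∘lookup; tabulate-cong; lookup-map;
         lookup-zipWith; zipWith-assoc; zipWith-identityʳ)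
open import Function using (_∘_; id)
open import Function.Bundles using (Equivalence)
open import Relation.Binary.PropositionalEquality
open import Relation.Nullary using (¬_; Dec; yes; no)
open import Relation.Nullary.Decidable using (T?; map′; _×-dec_)

open import Algebra.Properties.CommutativeSemigroup
  (CommutativeRing.+-commutativeSemigroup xor-∧-commutativeRing) using (interchange)

-- Boolean equality tests.  `x ≐ y` is exactly the body of EQ and of δ.

infix 4 _≐_ _≐ᵛ_

_≐_ : Bool → Bool → Bool
x ≐ y = not (x xor y)

_≐ᵛ_ : ∀ {n} → Vec Bool n → Vec Bool n → Bool
[] ≐ᵛ [] = true
(x ∷ xs) ≐ᵛ (y ∷ ys) = (x ≐ y) ∧ (xs ≐ᵛ ys)

false≢true : false ≢ true
false≢true ()

≐-sound : ∀ x y → (x ≐ y) ≡ true → x ≡ y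
≐-sound false false _ = refl
≐-sound true  true  _ = refl

≐-refl : ∀ x → (x ≐ x) ≡ true
≐-refl false = refl
≐-refl true  = refl

≐ᵛ-sound : ∀ {n} (xs ys : Vec Bool n) → (xs ≐ᵛ ys) ≡ true → xs ≡ ys
≐ᵛ-sound [] [] _ = refl
≐ᵛ-sound (x ∷ xs) (y ∷ ys) h =
  cong₂ _∷_ (≐-sound x y (∧-conicalˡ _ _ h)) (≐ᵛ-sound xs ys (∧-conicalʳ _ _ h))

guarded-swap : ∀ {m} (b c : Vec Bool m) (Q : Vec Bool m → Bool) →
  (b ≐ᵛ c) ∧ Q b ≡ Q c ∧ (b ≐ᵛ c)
guarded-swap b c Q with b ≐ᵛ c in eq
... | true rewrite ≐ᵛ-sound b c eq = sym (∧-identityʳ (Q c))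
... | false = sym (∧-zeroʳ (Q c))

holds : ∀ n → (Vec Bool n → Bool) → Bool
holds zero p = p []
holds (suc n) p = holds n (p ∘ (false ∷_)) ∧ holds n (p ∘ (true ∷_))

holds-sound : ∀ n (p : Vec Bool n → Bool) → holds n p ≡ true → ∀ x → p x ≡ true
holds-sound zero    p h [] = h
holds-sound (suc n) p h (false ∷ x) = holds-sound n _ (∧-conicalˡ _ _ h) x
holds-sound (suc n) p h (true ∷ x)  = holds-sound n _ (∧-conicalʳ _ _ h) x

-- Two relations given by computable formulas agree if `refl` proves the
-- evaluated comparison; used for all identities between concrete relations.
by-evaluation : ∀ n (S S′ : Rel₂ n) → holds n (λ v → S v ≐ S′ v) ≡ true →
  ∀ x → S x ≡ S′ x
by-evaluation n S S′ h x = ≐-sound _ _ (holds-sound n _ h x)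

search : ∀ n {P : Vec Bool n → Set} → (∀ x → Dec (P x)) → Dec (∃ P)
search zero P? = map′ ([] ,_) (λ { ([] , p) → p }) (P? [])
search (suc n) P? with search n (P? ∘ (false ∷_)) | search n (P? ∘ (true ∷_))
... | yes (x , p) | _ = yes (false ∷ x , p)
... | no _ | yes (x , p) = yes (true ∷ x , p)
... | no none₀ | no none₁ =
  no λ { (false ∷ x , p) → none₀ (x , p) ; (true ∷ x , p) → none₁ (x , p) }

indicator : Bool → ℕ
indicator true  = 1
indicator false = 0

count : ∀ m → (Vec Bool m → Bool) → ℕ
count zero p = indicator (p [])
count (suc m) p = count m (p ∘ (false ∷_)) + count m (p ∘ (true ∷_))

length-filter-map : ∀ {A B : Set} (p : B → Bool) (f : A → B) (xs : List A) →
  L.length (L.filterᵇ p (L.map f xs)) ≡ L.length (L.filterᵇ (p ∘ f) xs)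
length-filter-map p f L.[] = refl
length-filter-map p f (x L.∷ xs) with p (f x)
... | true  = cong suc (length-filter-map p f xs)
... | false = length-filter-map p f xs

count-allVecs : ∀ m (p : Vec Bool m → Bool) → L.length (L.filterᵇ p (allVecs m)) ≡ count m p
count-allVecs zero p with p []
... | true  = refl
... | false = refl
count-allVecs (suc m) p = begin
  L.length (L.filterᵇ p (L.map (false ∷_) vs L.++ L.map (true ∷_) vs))
    ≡⟨ cong L.length (filter-++ (T? ∘ p) (L.map (false ∷_) vs) (L.map (true ∷_) vs)) ⟩
  L.length (L.filterᵇ p (L.map (false ∷_) vs) L.++ L.filterᵇ p (L.map (true ∷_) vs))
    ≡⟨ length-++ (L.filterᵇ p (L.map (false ∷_) vs)) ⟩
  L.length (L.filterᵇ p (L.map (false ∷_) vs)) + L.length (L.filterᵇ p (L.map (true ∷_) vs))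
    ≡⟨ cong₂ _+_ (length-filter-map p (false ∷_) vs) (length-filter-map p (true ∷_) vs) ⟩
  L.length (L.filterᵇ (p ∘ (false ∷_)) vs) + L.length (L.filterᵇ (p ∘ (true ∷_)) vs)
    ≡⟨ cong₂ _+_ (count-allVecs m _) (count-allVecs m _) ⟩
  count (suc m) p ∎
  where
  open ≡-Reasoning
  vs : List (Vec Bool m)
  vs = allVecs m

count-cong : ∀ m {p q : Vec Bool m → Bool} → (∀ x → p x ≡ q x) → count m p ≡ count m q
count-cong zero    h = cong indicator (h [])
count-cong (suc m) h = cong₂ _+_ (count-cong m (h ∘ (false ∷_))) (count-cong m (h ∘ (true ∷_)))

count-none : ∀ m → count m (λ _ → false) ≡ 0
count-none zero    = refl
count-none (suc m) = cong₂ _+_ (count-none m) (count-none m)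

count-point : ∀ m (c : Vec Bool m) → count m (_≐ᵛ c) ≡ 1
count-point zero [] = refl
count-point (suc m) (false ∷ c) = cong₂ _+_ (count-point m c) (count-none m)
count-point (suc m) (true  ∷ c) = cong₂ _+_ (count-none m) (count-point m c)

extCount-unique : ∀ {n} m (S : Rel₂ (n + m)) (P : Rel₂ n) (e : Vec Bool n → Vec Bool m) →
  (∀ a b → S (a ++ b) ≡ P a ∧ (b ≐ᵛ e a)) → ∀ a → extCount m S a ≡ indicator (P a)
extCount-unique m S P e shape a = begin
  extCount m S a                       ≡⟨ count-allVecs m (λ b → S (a ++ b)) ⟩
  count m (λ b → S (a ++ b))           ≡⟨ count-cong m (shape a) ⟩
  count m (λ b → P a ∧ (b ≐ᵛ e a))     ≡⟨ single-candidate (P a) ⟩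
  indicator (P a)                      ∎
  where
  open ≡-Reasoning
  single-candidate : ∀ t → count m (λ b → t ∧ (b ≐ᵛ e a)) ≡ indicator t
  single-candidate true  = count-point m (e a)
  single-candidate false = count-none m

indicator-⊔ : ∀ s t → indicator s ⊔ indicator t ≡ indicator (s ∨ t)
indicator-⊔ true  true  = refl
indicator-⊔ true  false = refl
indicator-⊔ false t     = refl

max-indicator : ∀ {A : Set} (P : A → Bool) (xs : List A) →
  L.foldr _⊔_ 0 (L.map (indicator ∘ P) xs) ≡ indicator (any P xs)
max-indicator P L.[] = refl
max-indicator P (x L.∷ xs) =
  trans (cong (indicator (P x) ⊔_) (max-indicator P xs)) (indicator-⊔ (P x) (any P xs))

allVecs-complete : ∀ {n} (x : Vec Bool n) → x ∈ allVecs n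
allVecs-complete [] = here refl
allVecs-complete (false ∷ x) = ∈-++⁺ˡ (∈-map⁺ (false ∷_) (allVecs-complete x))
allVecs-complete {suc n} (true ∷ x) =
  ∈-++⁺ʳ (L.map (false ∷_) (allVecs n)) (∈-map⁺ (true ∷_) (allVecs-complete x))

any-allVecs : ∀ {n} (P : Vec Bool n → Bool) {x} → P x ≡ true → any P (allVecs n) ≡ true
any-allVecs P {x} Px =
  Equivalence.to T-≡ (any⁺ P (lose (allVecs-complete x) (Equivalence.from T-≡ Px)))

unique-projection : ∀ {n} m (S : Rel₂ (n + m)) (P : Rel₂ n) (e : Vec Bool n → Vec Bool m) →
  (∀ a b → S (a ++ b) ≡ P a ∧ (b ≐ᵛ e a)) → ∀ {a₀} → P a₀ ≡ true →
  ∀ a → maxImpl m S a ≡ P a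
unique-projection {n} m S P e shape P-a₀ a = begin
  extCount m S a ≡ᵇ L.foldr _⊔_ 0 (L.map (extCount m S) (allVecs n))
    ≡⟨ cong₂ _≡ᵇ_ (witnesses a) (cong (L.foldr _⊔_ 0) (map-cong witnesses (allVecs n))) ⟩
  indicator (P a) ≡ᵇ L.foldr _⊔_ 0 (L.map (indicator ∘ P) (allVecs n))
    ≡⟨ cong (indicator (P a) ≡ᵇ_) (trans (max-indicator P (allVecs n))
                                         (cong indicator (any-allVecs P P-a₀))) ⟩
  indicator (P a) ≡ᵇ 1
    ≡⟨ is-one (P a) ⟩
  P a ∎
  where
  open ≡-Reasoning
  witnesses : ∀ a → extCount m S a ≡ indicator (P a)
  witnesses = extCount-unique m S P e shape
  is-one : ∀ t → (indicator t ≡ᵇ 1) ≡ t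
  is-one true  = refl
  is-one false = refl

-- Selecting variables.  `select ρ v` is the body of `manip ρ`.

select : ∀ {p q} → (Fin p → Fin q) → Vec Bool q → Vec Bool p
select ρ v = tabulate (λ i → lookup v (ρ i))

juxtapose : ∀ {p r q} → (Fin p → Fin q) → (Fin r → Fin q) → Fin (p + r) → Fin q
juxtapose {zero}  ρ₁ ρ₂ i = ρ₂ i
juxtapose {suc p} ρ₁ ρ₂ zero = ρ₁ zero
juxtapose {suc p} ρ₁ ρ₂ (suc i) = juxtapose (ρ₁ ∘ suc) ρ₂ i

take-select : ∀ p {r q} (ρ₁ : Fin p → Fin q) (ρ₂ : Fin r → Fin q) v →
  take p (select (juxtapose ρ₁ ρ₂) v) ≡ select ρ₁ v
take-select zero    ρ₁ ρ₂ v = refl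
take-select (suc p) ρ₁ ρ₂ v = cong (lookup v (ρ₁ zero) ∷_) (take-select p (ρ₁ ∘ suc) ρ₂ v)

drop-select : ∀ p {r q} (ρ₁ : Fin p → Fin q) (ρ₂ : Fin r → Fin q) v →
  drop p (select (juxtapose ρ₁ ρ₂) v) ≡ select ρ₂ v
drop-select zero    ρ₁ ρ₂ v = refl
drop-select (suc p) ρ₁ ρ₂ v = drop-select p (ρ₁ ∘ suc) ρ₂ v

select-id : ∀ {q} (v : Vec Bool q) → select id v ≡ v
select-id = tabulate∘lookup

select-prefix : ∀ {n m} (x : Vec Bool n) (b : Vec Bool m) → select (_↑ˡ m) (x ++ b) ≡ x
select-prefix x b = trans (tabulate-cong (lookup-++ˡ x b)) (tabulate∘lookup x)

select-suffix : ∀ {n m} (x : Vec Bool n) (b : Vec Bool m) → select (n ↑ʳ_) (x ++ b) ≡ b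
select-suffix x b = trans (tabulate-cong (lookup-++ʳ x b)) (tabulate∘lookup b)

infixl 6 _⊕_
_⊕_ : ∀ {n} → Vec Bool n → Vec Bool n → Vec Bool n
_⊕_ = zipWith _xor_

XorClosed : ∀ {n} → Rel₂ n → Set
XorClosed {n} R = ∀ (x y z : Vec Bool n) →
  R x ≡ true → R y ≡ true → R z ≡ true → R (x ⊕ y ⊕ z) ≡ true

⊕-self : ∀ {n} (x : Vec Bool n) → x ⊕ x ≡ replicate n false
⊕-self [] = refl
⊕-self (x ∷ xs) = cong₂ _∷_ (xor-same x) (⊕-self xs)

⊕-twice : ∀ {n} (v d : Vec Bool n) → v ⊕ d ⊕ d ≡ v
⊕-twice v d = begin
  v ⊕ d ⊕ d               ≡⟨ zipWith-assoc xor-assoc v d d ⟩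
  v ⊕ (d ⊕ d)             ≡⟨ cong (v ⊕_) (⊕-self d) ⟩
  v ⊕ replicate _ false   ≡⟨ zipWith-identityʳ xor-identityʳ v ⟩
  v                       ∎
  where open ≡-Reasoning

dot-linear : ∀ {n} (r v w : Vec Bool n) → dot r (v ⊕ w) ≡ dot r v xor dot r w
dot-linear [] [] [] = refl
dot-linear (a ∷ r) (x ∷ v) (y ∷ w) = begin
  (a ∧ (x xor y)) xor dot r (v ⊕ w)
    ≡⟨ cong₂ _xor_ (∧-distribˡ-xor a x y) (dot-linear r v w) ⟩
  ((a ∧ x) xor (a ∧ y)) xor (dot r v xor dot r w)
    ≡⟨ interchange (a ∧ x) (a ∧ y) (dot r v) (dot r w) ⟩
  ((a ∧ x) xor dot r v) xor ((a ∧ y) xor dot r w) ∎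
  where open ≡-Reasoning

dot-zeros : ∀ {n} (v : Vec Bool n) → dot (replicate n false) v ≡ false
dot-zeros [] = refl
dot-zeros (_ ∷ v) = dot-zeros v

Solves : ∀ {n m} → Vec (Vec Bool n) m → Vec Bool m → Vec Bool n → Set
Solves {m = m} A b x = ∀ (i : Fin m) → dot (lookup A i) x ≡ lookup b i

Presents : ∀ {n m} → Rel₂ n → Vec (Vec Bool n) m → Vec Bool m → Set
Presents {n} R A b = ∀ (x : Vec Bool n) → (R x ≡ true → Solves A b x) × (Solves A b x → R x ≡ true)

fibre : ∀ {n} → Rel₂ (suc n) → Bool → Rel₂ n
fibre R c v = R (c ∷ v)

fibre-closed : ∀ {n} (R : Rel₂ (suc n)) c → XorClosed R → XorClosed (fibre R c)
fibre-closed R false closed x y z = closed (false ∷ x) (false ∷ y) (false ∷ z)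
fibre-closed R true  closed x y z = closed (true ∷ x) (true ∷ y) (true ∷ z)

-- If the first coordinate of R is constantly c, add the equation x₀ = c.
constant-coordinate : ∀ {n} (R : Rel₂ (suc n)) c → (∀ v → R (not c ∷ v) ≡ false) →
  Affine (fibre R c) → Affine R
constant-coordinate {n} R c other (m , A , b , H) =
  suc m , (true ∷ replicate n false) ∷ map (false ∷_) A , c ∷ b , presents
  where
  presents : Presents R ((true ∷ replicate n false) ∷ map (false ∷_) A) (c ∷ b)
  presents (t ∷ v) = sound , complete
    where
    head-row : dot (true ∷ replicate n false) (t ∷ v) ≡ t
    head-row = trans (cong (t xor_) (dot-zeros v)) (xor-identityʳ t)
    tail-row : ∀ j → dot (lookup (map (false ∷_) A) j) (t ∷ v) ≡ dot (lookup A j) v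
    tail-row j rewrite lookup-map j (false ∷_) A = refl
    forced : R (t ∷ v) ≡ true → t ≡ c
    forced h with t ≟ c
    ... | yes t≡c = t≡c
    ... | no t≢c = ⊥-elim (false≢true
      (trans (sym (other v)) (subst (λ s → R (s ∷ v) ≡ true) (¬-not t≢c) h)))
    sound : R (t ∷ v) ≡ true → Solves ((true ∷ replicate n false) ∷ map (false ∷_) A) (c ∷ b) (t ∷ v)
    sound h zero = trans head-row (forced h)
    sound h (suc j) =
      trans (tail-row j) (proj₁ (H v) (subst (λ s → R (s ∷ v) ≡ true) (forced h) h) j)
    complete : Solves ((true ∷ replicate n false) ∷ map (false ∷_) A) (c ∷ b) (t ∷ v) → R (t ∷ v) ≡ true
    complete h = subst (λ s → R (s ∷ v) ≡ true) (trans (sym (h zero)) head-row)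
      (proj₂ (H v) (λ j → trans (sym (tail-row j)) (h (suc j))))

-- If both fibres are nonempty, closure makes the 1-fibre the 0-fibre
-- translated by d = q ⊕ p; every equation r·v = β becomes (r·d) x₀ + r·v = β.
translated-fibre : ∀ {n} (R : Rel₂ (suc n)) → XorClosed R → ∀ p q →
  R (false ∷ p) ≡ true → R (true ∷ q) ≡ true → Affine (fibre R false) → Affine R
translated-fibre {n} R closed p q R-p R-q (m , A , b , H) =
  m , map (λ r → dot r d ∷ r) A , b , presents
  where
  d : Vec Bool n
  d = q ⊕ p
  row : ∀ j t v → dot (lookup (map (λ r → dot r d ∷ r) A) j) (t ∷ v)
                  ≡ dot (lookup A j) (if t then v ⊕ d else v)
  row j t v rewrite lookup-map j (λ r → dot r d ∷ r) A with t
  ... | false = cong (_xor dot (lookup A j) v) (∧-zeroʳ (dot (lookup A j) d))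
  ... | true  = trans (cong (_xor dot (lookup A j) v) (∧-identityʳ (dot (lookup A j) d)))
                      (trans (xor-comm (dot (lookup A j) d) (dot (lookup A j) v))
                             (sym (dot-linear (lookup A j) v d)))
  to-fibre : ∀ t v → R (t ∷ v) ≡ true → R (false ∷ (if t then v ⊕ d else v)) ≡ true
  to-fibre false v h = h
  to-fibre true  v h = subst (λ w → R (false ∷ w) ≡ true) (zipWith-assoc xor-assoc v q p)
    (closed (true ∷ v) (true ∷ q) (false ∷ p) h R-q R-p)
  from-fibre : ∀ t v → R (false ∷ (if t then v ⊕ d else v)) ≡ true → R (t ∷ v) ≡ true
  from-fibre false v h = h
  from-fibre true  v h = subst (λ w → R (true ∷ w) ≡ true)
    (trans (zipWith-assoc xor-assoc (v ⊕ d) q p) (⊕-twice v d))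
    (closed (false ∷ v ⊕ d) (true ∷ q) (false ∷ p) h R-q R-p)
  presents : Presents R (map (λ r → dot r d ∷ r) A) b
  presents (t ∷ v) =
    (λ h j → trans (row j t v) (proj₁ (H _) (to-fibre t v h) j)) ,
    (λ h → from-fibre t v (proj₂ (H _) (λ j → trans (sym (row j t v)) (h j))))

xor-closed⇒affine : ∀ n (R : Rel₂ n) → XorClosed R → Affine R
xor-closed⇒affine zero R closed with R [] in eq
... | true  = 0 , [] , [] , λ { [] → (λ _ ()) , (λ _ → eq) }
... | false = 1 , [] ∷ [] , true ∷ [] ,
  λ { [] → (λ h → ⊥-elim (false≢true (trans (sym eq) h))) , (λ h → ⊥-elim (false≢true (h zero))) }
xor-closed⇒affine (suc n) R closed =
  extend (search n (λ v → R (true ∷ v) ≟ true)) (search n (λ v → R (false ∷ v) ≟ true))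
  where
  affine-fibre : ∀ c → Affine (fibre R c)
  affine-fibre c = xor-closed⇒affine n (fibre R c) (fibre-closed R c closed)
  extend : Dec (∃ λ v → R (true ∷ v) ≡ true) → Dec (∃ λ v → R (false ∷ v) ≡ true) → Affine R
  extend (no none₁) _ = constant-coordinate R false (λ v → ¬-not (none₁ ∘ (v ,_))) (affine-fibre false)
  extend (yes _) (no none₀) = constant-coordinate R true (λ v → ¬-not (none₀ ∘ (v ,_))) (affine-fibre true)
  extend (yes (q , R-q)) (yes (p , R-p)) = translated-fibre R closed p q R-p R-q (affine-fibre false)

Violation : ∀ {n} → Rel₂ n → Set
Violation {n} R = ∃ λ (x : Vec Bool n) → ∃ λ y → ∃ λ z →
  R x ≡ true × R y ≡ true × R z ≡ true × R (x ⊕ y ⊕ z) ≡ false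

non-affine⇒violation : ∀ {n} (R : Rel₂ n) → ¬ Affine R → Violation R
non-affine⇒violation {n} R non-affine
  with search n (λ x → search n (λ y → search n (λ z →
         (R x ≟ true) ×-dec (R y ≟ true) ×-dec (R z ≟ true) ×-dec (R (x ⊕ y ⊕ z) ≟ false))))
... | yes violation = violation
... | no none = ⊥-elim (non-affine (xor-closed⇒affine n R closed))
  where
  closed : XorClosed R
  closed x y z R-x R-y R-z = ¬-not λ h → none (x , y , z , R-x , R-y , R-z , h)

NAND₂ OR₂ IMP₂ : Rel₂ 2
NAND₂ (x ∷ y ∷ []) = not (x ∧ y)
OR₂   (x ∷ y ∷ []) = x ∨ y
IMP₂  (x ∷ y ∷ []) = not x ∨ y

NAE₃ NandGraph : Rel₂ 3
NAE₃      (x ∷ y ∷ z ∷ []) = not ((x ≐ y) ∧ (y ≐ z))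
NandGraph (x ∷ y ∷ z ∷ []) = z ≐ not (x ∧ y)

MUX : Rel₂ 4
MUX (z ∷ s ∷ a ∷ b ∷ []) = z ≐ (if s then b else a)

-- The graph of a Boolean function, output variable first.
Graph : ∀ {n} → (Vec Bool n → Bool) → Rel₂ (suc n)
Graph f (z ∷ x) = z ≐ f x

NonAff3 : Bool → Bool → Bool → Bool → Rel₂ 3
NonAff3 e p q r (false ∷ false ∷ false ∷ []) = e
NonAff3 e p q r (true  ∷ false ∷ false ∷ []) = true
NonAff3 e p q r (false ∷ true  ∷ false ∷ []) = true
NonAff3 e p q r (false ∷ false ∷ true  ∷ []) = true
NonAff3 e p q r (true  ∷ true  ∷ true  ∷ []) = false
NonAff3 e p q r (false ∷ true  ∷ true  ∷ []) = p
NonAff3 e p q r (true  ∷ false ∷ true  ∷ []) = q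
NonAff3 e p q r (true  ∷ true  ∷ false ∷ []) = r

NonAff3-normal-form : ∀ (S : Rel₂ 3) →
  S (true ∷ false ∷ false ∷ []) ≡ true → S (false ∷ true ∷ false ∷ []) ≡ true →
  S (false ∷ false ∷ true ∷ []) ≡ true → S (true ∷ true ∷ true ∷ []) ≡ false →
  ∀ u → S u ≡ NonAff3 (S (false ∷ false ∷ false ∷ [])) (S (false ∷ true ∷ true ∷ []))
                      (S (true ∷ false ∷ true ∷ [])) (S (true ∷ true ∷ false ∷ [])) u
NonAff3-normal-form S e₁ e₂ e₃ e₁₂₃ = λ
  { (false ∷ false ∷ false ∷ []) → refl
  ; (true  ∷ false ∷ false ∷ []) → e₁
  ; (false ∷ true  ∷ false ∷ []) → e₂
  ; (false ∷ false ∷ true  ∷ []) → e₃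
  ; (true  ∷ true  ∷ true  ∷ []) → e₁₂₃
  ; (false ∷ true  ∷ true  ∷ []) → refl
  ; (true  ∷ false ∷ true  ∷ []) → refl
  ; (true  ∷ true  ∷ false ∷ []) → refl }

-- A tuple x of weight w has
-- (1 + w)(4 − w) extensions: 4, 6, 6, 4 for w = 0, 1, 2, 3.
AtMostOne : Bool → Bool → Bool → Bool
AtMostOne p q r = not (p ∧ q) ∧ (not (p ∧ r) ∧ not (q ∧ r))

NAEGadget : Rel₂ 9
NAEGadget (x₁ ∷ x₂ ∷ x₃ ∷ a₁ ∷ a₂ ∷ a₃ ∷ b₁ ∷ b₂ ∷ b₃ ∷ []) =
  ((not a₁ ∨ x₁) ∧ ((not a₂ ∨ x₂) ∧ (not a₃ ∨ x₃))) ∧ AtMostOne a₁ a₂ a₃ ∧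
  (not (b₁ ∧ x₁) ∧ (not (b₂ ∧ x₂) ∧ not (b₃ ∧ x₃))) ∧ AtMostOne b₁ b₂ b₃

-- A NAND circuit for the multiplexer on z s a b with inner wires
-- n = ¬s, t₁ = ¬(n ∧ a), t₂ = ¬(s ∧ b) and output z = ¬(t₁ ∧ t₂).
MUXGadget : Rel₂ 7
MUXGadget (z ∷ s ∷ a ∷ b ∷ n ∷ t₁ ∷ t₂ ∷ []) =
  NandGraph (s ∷ s ∷ n ∷ []) ∧ NandGraph (n ∷ a ∷ t₁ ∷ []) ∧
  NandGraph (s ∷ b ∷ t₂ ∷ []) ∧ NandGraph (t₁ ∷ t₂ ∷ z ∷ [])

-- Every column c = (p, q, r) of three tuples is the
-- value table, at 100, 010, 001, of one of the eight literals
-- u₁ u₂ u₃ ¬u₁ ¬u₂ ¬u₃ 0 1, and that literal takes the value p ⊕ q ⊕ r at 111.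

complements : Vec Bool 3 → Vec Bool 5
complements (u₁ ∷ u₂ ∷ u₃ ∷ []) = not u₁ ∷ not u₂ ∷ not u₃ ∷ false ∷ true ∷ []

literals : Vec Bool 3 → Vec Bool 8
literals u = u ++ complements u

literal-index : Vec Bool 3 → Fin 8
literal-index (true  ∷ false ∷ false ∷ []) = # 0
literal-index (false ∷ true  ∷ false ∷ []) = # 1
literal-index (false ∷ false ∷ true  ∷ []) = # 2
literal-index (false ∷ true  ∷ true  ∷ []) = # 3
literal-index (true  ∷ false ∷ true  ∷ []) = # 4
literal-index (true  ∷ true  ∷ false ∷ []) = # 5
literal-index (false ∷ false ∷ false ∷ []) = # 6
literal-index (true  ∷ true  ∷ true  ∷ []) = # 7

literal-at-100 : ∀ c → lookup (literals (true ∷ false ∷ false ∷ [])) (literal-index c) ≡ lookup c (# 0)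
literal-at-100 = by-evaluation 3 _ _ refl

literal-at-010 : ∀ c → lookup (literals (false ∷ true ∷ false ∷ [])) (literal-index c) ≡ lookup c (# 1)
literal-at-010 = by-evaluation 3 _ _ refl

literal-at-001 : ∀ c → lookup (literals (false ∷ false ∷ true ∷ [])) (literal-index c) ≡ lookup c (# 2)
literal-at-001 = by-evaluation 3 _ _ refl

literal-at-111 : ∀ c → lookup (literals (true ∷ true ∷ true ∷ [])) (literal-index c)
                       ≡ (lookup c (# 0) xor lookup c (# 1)) xor lookup c (# 2)
literal-at-111 = by-evaluation 3 _ _ refl

module Substitution {k} (x y z : Vec Bool k) where

  column : Fin k → Vec Bool 3
  column i = lookup x i ∷ lookup y i ∷ lookup z i ∷ []

  embed : Vec Bool 3 → Vec Bool k
  embed u = select (literal-index ∘ column) (literals u)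

  embed-interpolates : ∀ u (g : Vec Bool 3 → Bool) →
    (∀ c → lookup (literals u) (literal-index c) ≡ g c) → embed u ≡ tabulate (g ∘ column)
  embed-interpolates u g h = tabulate-cong (h ∘ column)

  embed-100 : embed (true ∷ false ∷ false ∷ []) ≡ x
  embed-100 = trans (embed-interpolates (true ∷ false ∷ false ∷ []) _ literal-at-100)
                    (tabulate∘lookup x)

  embed-010 : embed (false ∷ true ∷ false ∷ []) ≡ y
  embed-010 = trans (embed-interpolates (false ∷ true ∷ false ∷ []) _ literal-at-010)
                    (tabulate∘lookup y)

  embed-001 : embed (false ∷ false ∷ true ∷ []) ≡ z
  embed-001 = trans (embed-interpolates (false ∷ false ∷ true ∷ []) _ literal-at-001)
                    (tabulate∘lookup z)

  lookup-⊕⊕ : ∀ i → lookup (x ⊕ y ⊕ z) i ≡ (lookup x i xor lookup y i) xor lookup z i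
  lookup-⊕⊕ i = trans (lookup-zipWith _xor_ i (x ⊕ y) z)
                      (cong (_xor lookup z i) (lookup-zipWith _xor_ i x y))

  embed-111 : embed (true ∷ true ∷ true ∷ []) ≡ x ⊕ y ⊕ z
  embed-111 = begin
    embed (true ∷ true ∷ true ∷ [])
      ≡⟨ embed-interpolates (true ∷ true ∷ true ∷ []) _ literal-at-111 ⟩
    tabulate (λ i → (lookup x i xor lookup y i) xor lookup z i)
      ≡⟨ tabulate-cong (sym ∘ lookup-⊕⊕) ⟩
    tabulate (lookup (x ⊕ y ⊕ z))
      ≡⟨ tabulate∘lookup (x ⊕ y ⊕ z) ⟩
    x ⊕ y ⊕ z ∎
    where open ≡-Reasoning

module Closure {k} (R : Rel₂ k) (a : Bool) where

  C : ∀ {n} → Rel₂ n → Set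
  C S = ⟨ R ,NEQ,δ a ⟩max S

  conjOn : ∀ {p r q} {S : Rel₂ p} {S′ : Rel₂ r} → C S → C S′ →
    (ρ₁ : Fin p → Fin q) (ρ₂ : Fin r → Fin q) → C (λ v → S (select ρ₁ v) ∧ S′ (select ρ₂ v))
  conjOn {p} {S = S} {S′} hS hS′ ρ₁ ρ₂ =
    cl-ext (cl-manip (juxtapose ρ₁ ρ₂) (cl-conj hS hS′))
      (λ v → cong₂ (λ w w′ → S w ∧ S′ w′) (take-select p ρ₁ ρ₂ v) (drop-select p ρ₁ ρ₂ v))

  conjOn₃ : ∀ {p₁ p₂ p₃ q} {S₁ : Rel₂ p₁} {S₂ : Rel₂ p₂} {S₃ : Rel₂ p₃} →
    C S₁ → C S₂ → C S₃ → (ρ₁ : Fin p₁ → Fin q) (ρ₂ : Fin p₂ → Fin q) (ρ₃ : Fin p₃ → Fin q) →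
    C (λ v → S₁ (select ρ₁ v) ∧ (S₂ (select ρ₂ v) ∧ S₃ (select ρ₃ v)))
  conjOn₃ {S₁ = S₁} {S₂} {S₃} h₁ h₂ h₃ ρ₁ ρ₂ ρ₃ =
    cl-ext (conjOn h₁ (conjOn h₂ h₃ ρ₂ ρ₃) ρ₁ id)
      (λ v → cong (λ w → S₁ (select ρ₁ v) ∧ (S₂ (select ρ₂ w) ∧ S₃ (select ρ₃ w))) (select-id v))

  project : ∀ {n} m {S : Rel₂ (n + m)} (P : Rel₂ n) (e : Vec Bool n → Vec Bool m) → C S →
    (∀ a b → S (a ++ b) ≡ P a ∧ (b ≐ᵛ e a)) → ∀ {a₀} → P a₀ ≡ true → C P
  project m {S} P e hS shape P-a₀ = cl-ext (cl-max m hS) (unique-projection m S P e shape P-a₀)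

  -- δ_¬c(x) = ∃max y. NEQ(x, y) ∧ δ_c(y).
  negate-constant : ∀ c → C (δ c) → C (δ (not c))
  negate-constant false h = cl-ext
    (cl-max {n = 1} 1 (conjOn gen-NEQ h (lookup (# 0 ∷ # 1 ∷ [])) (lookup (# 1 ∷ []))))
    (by-evaluation 1 _ _ refl)
  negate-constant true h = cl-ext
    (cl-max {n = 1} 1 (conjOn gen-NEQ h (lookup (# 0 ∷ # 1 ∷ [])) (lookup (# 1 ∷ []))))
    (by-evaluation 1 _ _ refl)

  constants : ∀ c → C (δ c) → C (δ false) × C (δ true)
  constants false h = h , negate-constant false h
  constants true  h = negate-constant true h , h

  module WithConstants (δ₀ : C (δ false)) (δ₁ : C (δ true)) where

    constant : ∀ c → C (δ c)
    constant false = δ₀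
    constant true  = δ₁

    -- The graph b = complements(u), from three NEQs and the two constants.
    Complements : Rel₂ 8
    Complements (u₁ ∷ u₂ ∷ u₃ ∷ b) = b ≐ᵛ complements (u₁ ∷ u₂ ∷ u₃ ∷ [])

    complements-rel : C Complements
    complements-rel = cl-ext
      (conjOn (conjOn (conjOn (conjOn (cl-manip (lookup (# 0 ∷ # 3 ∷ [])) gen-NEQ)
        gen-NEQ id (lookup (# 1 ∷ # 4 ∷ [])))
        gen-NEQ id (lookup (# 2 ∷ # 5 ∷ [])))
        δ₀ id (lookup (# 6 ∷ [])))
        δ₁ id (lookup (# 7 ∷ [])))
      (by-evaluation 8 _ _ refl)

    -- Substituting literals into R stays in the closure: the five auxiliary
    -- variables are determined by u, so ∃max projects them away.
    substitution : ∀ (x y z : Vec Bool k) → R x ≡ true → C (R ∘ Substitution.embed x y z)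
    substitution x y z R-x =
      project 5 (R ∘ embed) complements (conjOn complements-rel gen-R id (literal-index ∘ column))
        shape {a₀ = true ∷ false ∷ false ∷ []} (trans (cong R embed-100) R-x)
      where
      open Substitution x y z
      shape : ∀ u b → Complements (select id (u ++ b)) ∧ R (select (literal-index ∘ column) (u ++ b))
                      ≡ R (embed u) ∧ (b ≐ᵛ complements u)
      shape u@(_ ∷ _ ∷ _ ∷ []) b@(_ ∷ _ ∷ _ ∷ _ ∷ _ ∷ []) =
        guarded-swap b (complements u) (λ c → R (select (literal-index ∘ column) (u ++ c)))

    -- Pin one coordinate of a ternary relation to the constant c and project
    -- it away; σ places the pinned coordinate at variable 2.
    pin : ∀ {S : Rel₂ 3} c (σ : Fin 3 → Fin 3) → C S →
      C (maxImpl {2} 1 (λ v → δ c (select (lookup (# 2 ∷ [])) v) ∧ S (select σ v)))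
    pin c σ hS = cl-max 1 (conjOn (constant c) hS (lookup (# 2 ∷ [])) σ)

    -- With e = 0, pinning a coordinate
    -- that is 0 in a present weight-2 tuple gives OR, and if there is none,
    -- projecting a coordinate gives NAND; with e = 1, pinning a coordinate to 0
    -- in an absent weight-2 tuple gives NAND, and if all are present, pinning
    -- a coordinate to 1 does.
    NonAff3⇒NAND⊎OR : ∀ {e p q r} → C (NonAff3 e p q r) → C NAND₂ ⊎ C OR₂
    NonAff3⇒NAND⊎OR {false} {_} {_} {true} h =
      inj₂ (cl-ext (pin false id h) (by-evaluation 2 _ _ refl))
    NonAff3⇒NAND⊎OR {false} {_} {true} {_} h =
      inj₂ (cl-ext (pin false (lookup (# 0 ∷ # 2 ∷ # 1 ∷ [])) h) (by-evaluation 2 _ _ refl))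
    NonAff3⇒NAND⊎OR {false} {true} {_} {_} h =
      inj₂ (cl-ext (pin false (lookup (# 2 ∷ # 0 ∷ # 1 ∷ [])) h) (by-evaluation 2 _ _ refl))
    NonAff3⇒NAND⊎OR {false} {false} {false} {false} h =
      inj₁ (cl-ext (cl-max {n = 2} 1 h) (by-evaluation 2 _ _ refl))
    NonAff3⇒NAND⊎OR {true} {_} {_} {false} h =
      inj₁ (cl-ext (pin false id h) (by-evaluation 2 _ _ refl))
    NonAff3⇒NAND⊎OR {true} {_} {false} {_} h =
      inj₁ (cl-ext (pin false (lookup (# 0 ∷ # 2 ∷ # 1 ∷ [])) h) (by-evaluation 2 _ _ refl))
    NonAff3⇒NAND⊎OR {true} {false} {_} {_} h =
      inj₁ (cl-ext (pin false (lookup (# 2 ∷ # 0 ∷ # 1 ∷ [])) h) (by-evaluation 2 _ _ refl))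
    NonAff3⇒NAND⊎OR {true} {true} {true} {true} h =
      inj₁ (cl-ext (pin true id h) (by-evaluation 2 _ _ refl))

    -- x ⊕ y ⊕ z ∉ R for x, y, z ∈ R makes the substituted relation NonAff3.
    violation⇒NAND⊎OR : Violation R → C NAND₂ ⊎ C OR₂
    violation⇒NAND⊎OR (x , y , z , R-x , R-y , R-z , R-xyz) =
      NonAff3⇒NAND⊎OR (cl-ext (substitution x y z R-x)
        (NonAff3-normal-form (R ∘ embed)
          (trans (cong R embed-100) R-x) (trans (cong R embed-010) R-y)
          (trans (cong R embed-001) R-z) (trans (cong R embed-111) R-xyz)))
      where open Substitution x y z

  -- Negating both arguments: Q(¬x, ¬y) = ∃max y₁ y₂. NEQ(x,y₁) ∧ NEQ(y,y₂) ∧ Q(y₁,y₂).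
  negate-both : ∀ {Q : Rel₂ 2} → C Q →
    C (maxImpl {2} 2 (λ v → NEQ (select (lookup (# 0 ∷ # 2 ∷ [])) v) ∧
                           (NEQ (select (lookup (# 1 ∷ # 3 ∷ [])) v) ∧
                            Q (select (lookup (# 2 ∷ # 3 ∷ [])) v))))
  negate-both hQ = cl-max 2 (conjOn₃ gen-NEQ gen-NEQ hQ
    (lookup (# 0 ∷ # 2 ∷ [])) (lookup (# 1 ∷ # 3 ∷ [])) (lookup (# 2 ∷ # 3 ∷ [])))

  -- NAND and OR are dual to each other.
  NAND⊎OR⇒NAND×OR : C NAND₂ ⊎ C OR₂ → C NAND₂ × C OR₂
  NAND⊎OR⇒NAND×OR (inj₁ nand) = nand , cl-ext (negate-both nand) (by-evaluation 2 _ _ refl)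
  NAND⊎OR⇒NAND×OR (inj₂ or)   = cl-ext (negate-both or) (by-evaluation 2 _ _ refl) , or

  module Gates (nand : C NAND₂) (or : C OR₂) where

    with₂ : ∀ {q} {S : Rel₂ q} {B : Rel₂ 2} → C S → C B → (i j : Fin q) →
      C (λ v → S (select id v) ∧ B (select (lookup (i ∷ j ∷ [])) v))
    with₂ hS hB i j = conjOn hS hB id (lookup (i ∷ j ∷ []))

    with₃ : ∀ {q} {S : Rel₂ q} {B : Rel₂ 3} → C S → C B → (i j l : Fin q) →
      C (λ v → S (select id v) ∧ B (select (lookup (i ∷ j ∷ l ∷ [])) v))
    with₃ hS hB i j l = conjOn hS hB id (lookup (i ∷ j ∷ l ∷ []))

    -- IMP(x, y) = ∃max w. NEQ(x, w) ∧ OR(w, y).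
    imp : C IMP₂
    imp = cl-ext (cl-max {n = 2} 1 (conjOn gen-NEQ or (lookup (# 0 ∷ # 2 ∷ [])) (lookup (# 2 ∷ # 1 ∷ []))))
                 (by-evaluation 2 _ _ refl)

    nae-gadget : C NAEGadget
    nae-gadget = cl-ext
      (with₂ (with₂ (with₂ (with₂ (with₂ (with₂ (with₂ (with₂ (with₂ (with₂ (with₂
        (cl-manip (lookup (# 3 ∷ # 0 ∷ [])) imp)
        imp (# 4) (# 1)) imp (# 5) (# 2))
        nand (# 3) (# 4)) nand (# 3) (# 5)) nand (# 4) (# 5))
        nand (# 6) (# 0)) nand (# 7) (# 1)) nand (# 8) (# 2))
        nand (# 6) (# 7)) nand (# 6) (# 8)) nand (# 7) (# 8))
      (by-evaluation 9 _ _ refl)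

    -- The counting gadget: ∃max over the six auxiliary variables keeps
    -- the tuples with 6 extensions, which are the not-all-equal ones.
    nae : C NAE₃
    nae = cl-ext (cl-max {n = 3} 6 nae-gadget) (by-evaluation 3 _ _ refl)

    -- z = ¬(x ∧ y)  iff  (z ∨ x) ∧ (z ∨ y) ∧ NAE(x, y, z).
    nand-graph : C NandGraph
    nand-graph = cl-ext
      (conjOn₃ or or nae (lookup (# 2 ∷ # 0 ∷ [])) (lookup (# 2 ∷ # 1 ∷ [])) id)
      (by-evaluation 3 _ _ refl)

    mux-gadget : C MUXGadget
    mux-gadget = cl-ext
      (with₃ (with₃ (with₃ (cl-manip (lookup (# 1 ∷ # 1 ∷ # 4 ∷ [])) nand-graph)
        nand-graph (# 4) (# 2) (# 5)) nand-graph (# 1) (# 3) (# 6)) nand-graph (# 5) (# 6) (# 0))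
      (by-evaluation 7 _ _ refl)

    -- The circuit's inner wires are determined by its inputs.
    mux : C MUX
    mux = cl-ext (cl-max {n = 4} 3 mux-gadget) (by-evaluation 4 _ _ refl)

  module Universal (δ₀ : C (δ false)) (δ₁ : C (δ true)) (mux : C MUX) where
    open WithConstants δ₀ δ₁ using (constant)

    -- Shannon expansion: f(x₀, x) = if x₀ then f(1, x) else f(0, x).
    graph : ∀ n (f : Vec Bool n → Bool) → C (Graph f)
    graph zero f = cl-ext (constant (f [])) (λ { (z ∷ []) → cong not (xor-comm (f []) z) })
    graph (suc n) f =
      project 2 (Graph f) cofactors (conjOn₃ mux (graph n f₀) (graph n f₁) ρ-mux ρ₀ ρ₁)
        shape {a₀ = f (false ∷ zeros) ∷ false ∷ zeros} (≐-refl (f (false ∷ zeros)))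
      where
      open ≡-Reasoning
      f₀ f₁ : Vec Bool n → Bool
      f₀ x = f (false ∷ x)
      f₁ x = f (true ∷ x)
      zeros : Vec Bool n
      zeros = replicate n false
      -- Variables: z, x₀, x, then the cofactor values z₀ = f₀ x and z₁ = f₁ x.
      cofactors : Vec Bool (suc (suc n)) → Vec Bool 2
      cofactors (_ ∷ _ ∷ x) = f₀ x ∷ f₁ x ∷ []
      aux₀ aux₁ : Fin (suc (suc n) + 2)
      aux₀ = suc (suc (n ↑ʳ # 0))
      aux₁ = suc (suc (n ↑ʳ # 1))
      ρ-mux : Fin 4 → Fin (suc (suc n) + 2)
      ρ-mux = lookup (zero ∷ suc zero ∷ aux₀ ∷ aux₁ ∷ [])
      ρ₀ ρ₁ : Fin (suc n) → Fin (suc (suc n) + 2)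
      ρ₀ zero = aux₀
      ρ₀ (suc j) = suc (suc (j ↑ˡ 2))
      ρ₁ zero = aux₁
      ρ₁ (suc j) = suc (suc (j ↑ˡ 2))
      selects : ∀ z s z₀ z₁ A B →
        MUX (z ∷ s ∷ z₀ ∷ z₁ ∷ []) ∧ ((z₀ ≐ A) ∧ (z₁ ≐ B))
        ≡ (z ≐ (if s then B else A)) ∧ ((z₀ ≐ A) ∧ ((z₁ ≐ B) ∧ true))
      selects z s z₀ z₁ A B = by-evaluation 6
        (λ { (z ∷ s ∷ z₀ ∷ z₁ ∷ A ∷ B ∷ []) → MUX (z ∷ s ∷ z₀ ∷ z₁ ∷ []) ∧ ((z₀ ≐ A) ∧ (z₁ ≐ B)) })
        (λ { (z ∷ s ∷ z₀ ∷ z₁ ∷ A ∷ B ∷ []) → (z ≐ (if s then B else A)) ∧ ((z₀ ≐ A) ∧ ((z₁ ≐ B) ∧ true)) })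
        refl (z ∷ s ∷ z₀ ∷ z₁ ∷ A ∷ B ∷ [])
      shannon : ∀ x₀ x → (if x₀ then f₁ x else f₀ x) ≡ f (x₀ ∷ x)
      shannon false x = refl
      shannon true  x = refl
      shape : ∀ a b → MUX (select ρ-mux (a ++ b)) ∧ (Graph f₀ (select ρ₀ (a ++ b)) ∧ Graph f₁ (select ρ₁ (a ++ b)))
                      ≡ Graph f a ∧ (b ≐ᵛ cofactors a)
      shape (z ∷ x₀ ∷ x) b@(z₀ ∷ z₁ ∷ []) = begin
        MUX (z ∷ x₀ ∷ lookup (x ++ b) (n ↑ʳ # 0) ∷ lookup (x ++ b) (n ↑ʳ # 1) ∷ []) ∧
          ((lookup (x ++ b) (n ↑ʳ # 0) ≐ f₀ (select (_↑ˡ 2) (x ++ b))) ∧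
           (lookup (x ++ b) (n ↑ʳ # 1) ≐ f₁ (select (_↑ˡ 2) (x ++ b))))
          ≡⟨ cong₂ (λ { (w₀ ∷ w₁ ∷ []) w → MUX (z ∷ x₀ ∷ w₀ ∷ w₁ ∷ []) ∧ ((w₀ ≐ f₀ w) ∧ (w₁ ≐ f₁ w)) })
                   (select-suffix x b) (select-prefix x b) ⟩
        MUX (z ∷ x₀ ∷ z₀ ∷ z₁ ∷ []) ∧ ((z₀ ≐ f₀ x) ∧ (z₁ ≐ f₁ x))
          ≡⟨ selects z x₀ z₀ z₁ (f₀ x) (f₁ x) ⟩
        (z ≐ (if x₀ then f₁ x else f₀ x)) ∧ ((z₀ ≐ f₀ x) ∧ ((z₁ ≐ f₁ x) ∧ true))
          ≡⟨ cong (λ t → (z ≐ t) ∧ ((z₀ ≐ f₀ x) ∧ ((z₁ ≐ f₁ x) ∧ true))) (shannon x₀ x) ⟩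
        Graph f (z ∷ x₀ ∷ x) ∧ (b ≐ᵛ cofactors (z ∷ x₀ ∷ x)) ∎

    -- A nonempty S is ∃max z. Graph S (z, x) ∧ δ₁(z); the empty relation of
    -- arity n + 1 is δ₀(x₀) ∧ δ₁(x₀).
    every-relation : ∀ n (S : Rel₂ (suc n)) → C S
    every-relation n S with search (suc n) (λ x → S x ≟ true)
    ... | yes (x₀ , S-x₀) =
      project 1 S (λ _ → true ∷ []) (conjOn (graph (suc n) S) δ₁ ρ-graph (lookup ((suc n ↑ʳ # 0) ∷ [])))
        shape S-x₀
      where
      ρ-graph : Fin (suc (suc n)) → Fin (suc n + 1)
      ρ-graph zero = suc n ↑ʳ # 0
      ρ-graph (suc j) = j ↑ˡ 1
      one-witness : ∀ z s → (z ≐ s) ∧ δ true (z ∷ []) ≡ s ∧ ((z ≐ true) ∧ true)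
      one-witness false false = refl
      one-witness false true  = refl
      one-witness true  false = refl
      one-witness true  true  = refl
      shape : ∀ x b → Graph S (select ρ-graph (x ++ b)) ∧ δ true (select (lookup ((suc n ↑ʳ # 0) ∷ [])) (x ++ b))
                      ≡ S x ∧ (b ≐ᵛ (true ∷ []))
      shape x b@(z ∷ []) =
        trans (cong₂ (λ w w′ → (w ≐ S w′) ∧ δ true (w ∷ [])) (lookup-++ʳ x b (# 0)) (select-prefix x b))
              (one-witness z (S x))
    ... | no empty = cl-ext (cl-manip (λ _ → zero) (cl-conj δ₀ δ₁)) (λ x →
      trans (contradictory (lookup x zero)) (sym (¬-not (empty ∘ (x ,_)))))
      where
      contradictory : ∀ t → δ false (t ∷ []) ∧ δ true (t ∷ []) ≡ false
      contradictory false = refl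
      contradictory true  = refl

lemma18 : ∀ {k} (R : Rel₂ k) → ¬ Affine R → (a : Bool) →
    ∀ n (S : Rel₂ (suc n)) → ⟨ R ,NEQ,δ a ⟩max S
lemma18 R non-affine a n S = every-relation n S
  where
  open Closure R a
  δ₀ : C (δ false)
  δ₀ = proj₁ (constants a gen-δ)
  δ₁ : C (δ true)
  δ₁ = proj₂ (constants a gen-δ)
  nand⊎or : C NAND₂ ⊎ C OR₂
  nand⊎or = WithConstants.violation⇒NAND⊎OR δ₀ δ₁ (non-affine⇒violation R non-affine)
  nand×or : C NAND₂ × C OR₂
  nand×or = NAND⊎OR⇒NAND×OR nand⊎or
  open Universal δ₀ δ₁ (Gates.mux (proj₁ nand×or) (proj₂ nand×or))
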